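{- Let $(Q,\le_Q)$ be a non-empty quasi-order and let $f\colon\mathsf{T_f}(Q)\to i^F_{\omega^\omega}(Q)$ be defined recursively by $f(\cdot q)=\langle q\rangle$ (the sequence of length $1$) and $f(\cdot(\tau_0,\dots,\tau_{k-1}))=(f(\tau_0)+f(\tau_1)+\dots+f(\tau_{k-1}))^\omega$ (for a fixed enumeration of the children). Then $f$ is an order-embedding: for all $\sigma,\tau\in\mathsf{T_f}(Q)$, $\sigma\le_T\tau$ iff $f(\sigma)\preceq f(\tau)$.
   Context: $\mathsf{T_f}(Q)$: smallest class containing a leaf $\cdot q$ for each $q\in Q$ and, for every finite non-empty set $\{\tau_0,\dots,\tau_{k-1}\}$ of its members, the tree $\cdot(\tau_0,\dots,\tau_{k-1})$; ordered by $\le_T$: $\cdot x\le_T\cdot y$ iff $x\le_Q y$; $\cdot x\le_T\cdot(\tau_0,\dots,\tau_{l-1})$ iff $\cdot x\le_T\tau_j$ for some $j$; $\cdot(\sigma_0,\dots,\sigma_{k-1})\le_T\cdot(\tau_0,\dots,\tau_{l-1})$ iff each $\sigma_i\le_T$ some $\tau_j$; an internal tree is never $\le_T$ a leaf. A transfinite sequence over $Q$ is $\sigma\colon\alpha\to Q$ with $\alpha=|\sigma|\ge1$; $\sigma\preceq\tau$ iff there is a strictly increasing $h\colon|\sigma|\to|\tau|$ with $\sigma(i)\le_Q\tau(h(i))$. Concatenation $\sigma+\tau$ has length $|\sigma|+|\tau|$, equals $\sigma$ on $[0,|\sigma|)$ and $(\sigma+\tau)(|\sigma|+i)=\tau(i)$.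 For $\alpha\ge1$, $\sigma^\alpha$ has length $|\sigma|\cdot\alpha$ with $\sigma^\alpha(|\sigma|\cdot\delta+\iota)=\sigma(\iota)$ for $\delta<\alpha$, $\iota<|\sigma|$. Indecomposable: $\sigma\preceq$ every proper tail $i\mapsto\sigma(\delta+i)$, $0<\delta<|\sigma|$. $i^F_{\omega^\omega}(Q)$ is the set of indecomposable sequences with finite range and length $<\omega^\omega$, ordered by $\preceq$. -}

module Defs where

open import Data.Nat using (ℕ; zero; suc; _<_; _≤_; _≤?_; _<?_; _≟_)
open import Data.List using (List; []; _∷_; _++_; takeWhile; length)
open import Data.List.NonEmpty using (List⁺; _∷_; toList)
open import Data.List.Relation.Unary.Linked using (Linked)
open import Data.List.Relation.Unary.Any using (Any)
open import Data.List.Relation.Unary.All using (All)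
open import Data.List.Membership.Propositional using (_∈_)
open import Data.List.Relation.Binary.Lex.Strict using (Lex-<; <-decidable)
open import Data.Product using (Σ; ∃; _×_)
open import Relation.Binary.PropositionalEquality using (_≡_; _≢_)
open import Relation.Nullary using (yes; no; does)
open import Data.Bool using (if_then_else_)

-- Ordinals below ω^ω in Cantor normal form.
-- A list  e₁ ∷ e₂ ∷ … ∷ eₖ ∷ []  denotes  ω^e₁ + ω^e₂ + … + ω^eₖ ;
-- it is a (canonical) ordinal iff e₁ ≥ e₂ ≥ … ≥ eₖ  (predicate Valid).
-- [] denotes 0.

Ord : Set
Ord = List ℕ

Valid : Ord → Set
Valid = Linked (λ a b → b ≤ a)

-- ordinal order on CNFs = lexicographic order (proper prefix is smaller)
_<ₒ_ : Ord → Ord → Set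
_<ₒ_ = Lex-< _≡_ _<_

_<ₒ?_ : (a b : Ord) → _
_<ₒ?_ = <-decidable _≟_ _<?_

_+ₒ_ : Ord → Ord → Ord
α +ₒ [] = α
α +ₒ (b ∷ β) = takeWhile (b ≤?_) α ++ (b ∷ β)

-- for δ ≤ α: the unique γ with δ +ₒ γ ≡ α
leftSub : Ord → Ord → Ord
leftSub [] α = α
leftSub (d ∷ δ) [] = []
leftSub (d ∷ δ) (a ∷ α) with d ≟ a
... | yes _ = leftSub δ α
... | no _ = a ∷ α

-- α · ω  (for α ≥ 1, α = ω^e + … gives ω^(e+1))
_·ω : Ord → Ord
[] ·ω = []
(e ∷ _) ·ω = suc e ∷ []

-- remainder of i modulo α: repeatedly subtract α on the left while α ≤ i
-- (fuel = length i suffices, each step shortens i)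
remFuel : ℕ → Ord → Ord → Ord
remFuel zero α i = i
remFuel (suc n) α i = if does (i <ₒ? α) then i else remFuel n α (leftSub α i)

rem : Ord → Ord → Ord
rem α i = remFuel (length i) α i

-- Transfinite sequences of length < ω^ω.
-- Only the values at valid positions i <ₒ len are meaningful.

record Seq (Q : Set) : Set where
  constructor mkSeq
  field
    len : Ord
    at  : Ord → Q
open Seq public

_+ₛ_ : {Q : Set} → Seq Q → Seq Q → Seq Q
σ +ₛ τ = mkSeq (len σ +ₒ len τ)
               (λ i → if does (i <ₒ? len σ) then at σ i else at τ (leftSub (len σ) i))

-- σ^ω : (σ^ω)(|σ|·n + ι) = σ(ι)
_^ω : {Q : Set} → Seq Q → Seq Q
σ ^ω = mkSeq (len σ ·ω) (λ i → at σ (rem (len σ) i))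

module TreeDefs {Q : Set} (_≤_ : Q → Q → Set) where

  -- finite labelled trees T_f(Q); children as a non-empty list
  -- (an enumeration of the finite non-empty set of children)
  data Tree : Set where
    leaf : Q → Tree
    node : List⁺ Tree → Tree

  data _≤T_ : Tree → Tree → Set where
    leaf≤leaf : ∀ {x y} → x ≤ y → leaf x ≤T leaf y
    leaf≤node : ∀ {x ts} → Any (leaf x ≤T_) (toList ts) → leaf x ≤T node ts
    node≤node : ∀ {ss ts} → All (λ s → Any (s ≤T_) (toList ts)) (toList ss) →
                node ss ≤T node ts
  -- (no constructor: an internal tree is never ≤T a leaf)

  _≼_ : Seq Q → Seq Q → Set
  σ ≼ τ = Σ (Ord → Ord) λ h →
      (∀ i → Valid i → i <ₒ len σ → Valid (h i) × h i <ₒ len τ × at σ i ≤ at τ (h i))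
    × (∀ i j → Valid i → Valid j → i <ₒ j → j <ₒ len σ → h i <ₒ h j)

  FiniteRange : Seq Q → Set
  FiniteRange σ = Σ (List Q) λ xs → ∀ i → Valid i → i <ₒ len σ → at σ i ∈ xs

  -- σ ≼ every proper tail  i ↦ σ(δ + i)  (0 < δ < |σ|), whose length is
  -- the γ with δ + γ = |σ|
  Indecomposable : Seq Q → Set
  Indecomposable σ = ∀ δ γ → Valid δ → Valid γ → [] <ₒ δ → δ <ₒ len σ →
    δ +ₒ γ ≡ len σ → σ ≼ mkSeq γ (λ i → at σ (δ +ₒ i))

  -- membership in i^F_{ω^ω}(Q) (length < ω^ω is automatic for Ord)
  InIF : Seq Q → Set
  InIF σ = Valid (len σ) × len σ ≢ [] × FiniteRange σ × Indecomposable σ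

  mutual
    f : Tree → Seq Q
    f (leaf q) = mkSeq (0 ∷ []) (λ _ → q)
    f (node (t ∷ ts)) = (sumF t ts) ^ω

    sumF : Tree → List Tree → Seq Q
    sumF t [] = f t
    sumF t (u ∷ us) = f t +ₛ sumF u us

{-# OPTIONS --safe #-}
module Submission where

-- A position of f τ is a copy number n of the concatenated children together with a child
-- and, recursively, a position inside that child's sequence. Every ordinal below σ·ω is
-- uniquely σ·n + ι with ι < σ, so enc/dec identify these positions, ordered lexicographically,
-- with the ordinals below |f τ|. Hence f σ ≼ f τ says exactly that the positions of σ embed
-- into those of τ, preserving the order and increasing the labels.
--
-- A tree embedding σ ≤T τ yields such a map by sending the i-th child in copy n of σ's
-- children into copy nK + i of τ's, K being the number of children of σ. Conversely, take an
-- embedding of the positions of a node ρ whose image stays below some position w. The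
-- (copy, child) blocks containing the images of the first positions of consecutive copies of
-- ρ's children increase but stay below the block of w, so two consecutive ones coincide; the
-- whole copy in between then lies inside a single child of τ, and induction on ρ applies.
-- Finally, shifting every position by one copy more than the copy of δ embeds f τ into its
-- tail after δ, which is indecomposability.

open import Defs
open import Data.Bool using (true; false; if_then_else_)
open import Data.Empty using (⊥-elim)
open import Data.List using (List; []; _∷_; _++_; takeWhile; length)
open import Data.List.NonEmpty using (_∷_; toList)
open import Data.List.Properties using (++-conicalʳ)
open import Data.List.Membership.Propositional using (_∈_)
open import Data.List.Membership.Propositional.Properties using (∈-++⁺ˡ; ∈-++⁺ʳ)
open import Data.List.Relation.Binary.Lex.Core using (halt; this; next; base)
import Data.List.Relation.Binary.Lex.Strict as Lex
open import Data.List.Relation.Binary.Pointwise using (Pointwise-≡⇒≡; ≡⇒Pointwise-≡)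
open import Data.List.Relation.Unary.All as All using (All; []; _∷_)
open import Data.List.Relation.Unary.All.Properties using (++⁺; takeWhile⁺)
open import Data.List.Relation.Unary.AllPairs using (AllPairs; []; _∷_)
open import Data.List.Relation.Unary.Any as Any using (Any; here; there)
open import Data.List.Relation.Unary.Linked.Properties using (Linked⇒AllPairs; AllPairs⇒Linked)
open import Data.Nat using (ℕ; zero; suc; _<_; _≤_; _≥_; _≤ᵇ_; z≤n; s≤s; _+_; _*_)
open import Data.Nat.Properties
open import Data.Product as Product using (Σ; ∃; _×_; _,_; proj₁; proj₂)
open import Data.Sum as Sum using (_⊎_; inj₁; inj₂)
open import Function using (_∘_)
open import Function.Bundles using (_⇔_; mk⇔)
open import Relation.Binary.Definitions using (Transitive; Irreflexive; Asymmetric; tri<; tri≈; tri>)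
open import Relation.Binary.PropositionalEquality
open import Relation.Binary.Structures using (IsPreorder)
open import Relation.Nullary using (¬_; yes; no; does; ofʸ; ofⁿ)

module StrictlyMonotone {A B : Set} {_<₁_ : A → A → Set} {_<₂_ : B → B → Set}
  (compare : ∀ x y → x <₁ y ⊎ x ≡ y ⊎ y <₁ x)
  (irrefl : Irreflexive _≡_ _<₂_) (asym : Asymmetric _<₂_)
  {h : A → B} (mono : ∀ {x y} → x <₁ y → h x <₂ h y) where

  reflects : ∀ {x y} → h x <₂ h y → x <₁ y
  reflects {x} {y} hx<hy with compare x y
  ... | inj₁ x<y = x<y
  ... | inj₂ (inj₁ refl) = ⊥-elim (irrefl refl hx<hy)
  ... | inj₂ (inj₂ y<x) = ⊥-elim (asym hx<hy (mono y<x))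

  injective : ∀ {x y} → h x ≡ h y → x ≡ y
  injective {x} {y} hx≡hy with compare x y
  ... | inj₁ x<y = ⊥-elim (irrefl hx≡hy (mono x<y))
  ... | inj₂ (inj₁ x≡y) = x≡y
  ... | inj₂ (inj₂ y<x) = ⊥-elim (irrefl (sym hx≡hy) (mono y<x))

mixed-radix-< : ∀ {m n a b} K → m < n → a < K → m * K + a < n * K + b
mixed-radix-< {m} {n} {a} {b} K m<n a<K = begin-strict
  m * K + a  <⟨ +-monoʳ-< (m * K) a<K ⟩
  m * K + K  ≡⟨ +-comm (m * K) K ⟩
  suc m * K  ≤⟨ *-monoˡ-≤ K m<n ⟩
  n * K      ≤⟨ m≤m+n (n * K) b ⟩
  n * K + b  ∎
  where open ≤-Reasoning

monotone-bounded-stalls : (c : ℕ → ℕ) → (∀ n → c n ≤ c (suc n)) →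
  ∀ B → (∀ n → c n ≤ B) → ∃ λ k → c k ≡ c (suc k)
monotone-bounded-stalls c mono B bounded = go B 0 (m≤m+n B (c 0))
  where
  go : ∀ d n → B ≤ d + c n → ∃ λ k → c k ≡ c (suc k)
  go d n B≤d+cn with c n ≟ c (suc n)
  ... | yes stall = n , stall
  go zero n B≤cn | no cn≢cn+1 =
    ⊥-elim (<⇒≱ (≤∧≢⇒< (mono n) cn≢cn+1) (≤-trans (bounded (suc n)) B≤cn))
  go (suc d) n B≤d+cn | no cn≢cn+1 =
    go d (suc n) (≤-trans B≤d+cn (≤-trans (≤-reflexive (sym (+-suc d (c n))))
                                           (+-monoʳ-≤ d (≤∧≢⇒< (mono n) cn≢cn+1))))

-- Ordinals below ω^ω

_≤ₒ_ : Ord → Ord → Set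
α ≤ₒ β = α <ₒ β ⊎ α ≡ β

<ₒ-irrefl : Irreflexive _≡_ _<ₒ_
<ₒ-irrefl refl = Lex.<-irreflexive <-irrefl (≡⇒Pointwise-≡ refl)

<ₒ-trans : Transitive _<ₒ_
<ₒ-trans = Lex.<-transitive isEquivalence (resp₂ _<_) <-trans

<ₒ-asym : Asymmetric _<ₒ_
<ₒ-asym α<β β<α = <ₒ-irrefl refl (<ₒ-trans α<β β<α)

<ₒ-≤ₒ-trans : ∀ {α β γ} → α <ₒ β → β ≤ₒ γ → α <ₒ γ
<ₒ-≤ₒ-trans α<β (inj₁ β<γ) = <ₒ-trans α<β β<γ
<ₒ-≤ₒ-trans α<β (inj₂ refl) = α<β

<ₒ-cmp : ∀ α β → α <ₒ β ⊎ α ≡ β ⊎ β <ₒ α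
<ₒ-cmp α β with Lex.<-compare sym <-cmp α β
... | tri< α<β _ _ = inj₁ α<β
... | tri≈ _ α≈β _ = inj₂ (inj₁ (Pointwise-≡⇒≡ α≈β))
... | tri> _ _ β<α = inj₂ (inj₂ β<α)

≮ₒ⇒≥ₒ : ∀ {α β} → ¬ α <ₒ β → β ≤ₒ α
≮ₒ⇒≥ₒ {α} {β} α≮β with <ₒ-cmp α β
... | inj₁ α<β = ⊥-elim (α≮β α<β)
... | inj₂ (inj₁ refl) = inj₂ refl
... | inj₂ (inj₂ β<α) = inj₁ β<α

α<ₒα+ₒb∷β : ∀ α b β → α <ₒ (α +ₒ (b ∷ β))
α<ₒα+ₒb∷β [] b β = halt
α<ₒα+ₒb∷β (a ∷ α) b β with b ≤ᵇ a | ≤ᵇ-reflects-≤ b a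
... | true | ofʸ _ = next refl (α<ₒα+ₒb∷β α b β)
... | false | ofⁿ b≰a = this (≰⇒> b≰a)

α≤ₒα+ₒβ : ∀ α β → α ≤ₒ (α +ₒ β)
α≤ₒα+ₒβ α [] = inj₂ refl
α≤ₒα+ₒβ α (b ∷ β) = inj₁ (α<ₒα+ₒb∷β α b β)

++-monoʳ-<ₒ : ∀ xs {β γ} → β <ₒ γ → (xs ++ β) <ₒ (xs ++ γ)
++-monoʳ-<ₒ [] β<γ = β<γ
++-monoʳ-<ₒ (x ∷ xs) β<γ = next refl (++-monoʳ-<ₒ xs β<γ)

+ₒ-monoʳ-<-this : ∀ α {b c β γ} → b < c → (α +ₒ (b ∷ β)) <ₒ (α +ₒ (c ∷ γ))
+ₒ-monoʳ-<-this [] b<c = this b<c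
+ₒ-monoʳ-<-this (a ∷ α) {b} {c} b<c with b ≤ᵇ a | ≤ᵇ-reflects-≤ b a | c ≤ᵇ a | ≤ᵇ-reflects-≤ c a
... | true  | ofʸ _   | true  | ofʸ _   = next refl (+ₒ-monoʳ-<-this α b<c)
... | true  | ofʸ _   | false | ofⁿ c≰a = this (≰⇒> c≰a)
... | false | ofⁿ b≰a | true  | ofʸ c≤a = ⊥-elim (b≰a (≤-trans (<⇒≤ b<c) c≤a))
... | false | ofⁿ _   | false | ofⁿ _   = this b<c

+ₒ-monoʳ-< : ∀ α {β γ} → β <ₒ γ → (α +ₒ β) <ₒ (α +ₒ γ)
+ₒ-monoʳ-< α (base ())
+ₒ-monoʳ-< α (halt {b} {β}) = α<ₒα+ₒb∷β α b β
+ₒ-monoʳ-< α (this b<c) = +ₒ-monoʳ-<-this α b<c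
+ₒ-monoʳ-< α (next {b} refl β<γ) = ++-monoʳ-<ₒ (takeWhile (b ≤?_) α) (next refl β<γ)

+ₒ-cancelˡ-< : ∀ α {β γ} → (α +ₒ β) <ₒ (α +ₒ γ) → β <ₒ γ
+ₒ-cancelˡ-< α = StrictlyMonotone.reflects <ₒ-cmp <ₒ-irrefl <ₒ-asym (+ₒ-monoʳ-< α)

Descending : Ord → Set
Descending = AllPairs _≥_

valid⇒descending : ∀ {α} → Valid α → Descending α
valid⇒descending = Linked⇒AllPairs (λ b≤a c≤b → ≤-trans c≤b b≤a)

descending⇒valid : ∀ {α} → Descending α → Valid α
descending⇒valid = AllPairs⇒Linked

All≤⇒<ω^suc : ∀ {e α} → All (_≤ e) α → α <ₒ (suc e ∷ [])
All≤⇒<ω^suc [] = halt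
All≤⇒<ω^suc (a≤e ∷ _) = this (s≤s a≤e)

<ω^suc⇒All≤ : ∀ {e α} → Descending α → α <ₒ (suc e ∷ []) → All (_≤ e) α
<ω^suc⇒All≤ [] _ = []
<ω^suc⇒All≤ (α≤a ∷ _) (this (s≤s a≤e)) = a≤e ∷ All.map (λ b≤a → ≤-trans b≤a a≤e) α≤a
<ω^suc⇒All≤ (_ ∷ _) (next _ (base ()))

All-+ₒ : ∀ {P : ℕ → Set} {α β} → All P α → All P β → All P (α +ₒ β)
All-+ₒ {β = []} pα _ = pα
All-+ₒ {β = b ∷ β} pα pβ = ++⁺ (takeWhile⁺ (b ≤?_) pα) pβ

descending-+ₒ : ∀ {α β} → Descending α → Descending β → Descending (α +ₒ β)
descending-+ₒ {β = []} dα _ = dα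
descending-+ₒ {[]} {b ∷ β} _ dβ = dβ
descending-+ₒ {a ∷ α} {b ∷ β} (α≤a ∷ dα) dβ@(β≤b ∷ _) with b ≤ᵇ a | ≤ᵇ-reflects-≤ b a
... | true  | ofʸ b≤a =
  All-+ₒ α≤a (b≤a ∷ All.map (λ c≤b → ≤-trans c≤b b≤a) β≤b) ∷ descending-+ₒ dα dβ
... | false | ofⁿ _   = dβ

leftSub-tail-closed : ∀ {P : Ord → Set} → (∀ {a α} → P (a ∷ α) → P α) →
  ∀ δ {α} → P α → P (leftSub δ α)
leftSub-tail-closed tail [] p = p
leftSub-tail-closed tail (d ∷ δ) {[]} p = p
leftSub-tail-closed {P} tail (d ∷ δ) {a ∷ α} p with d ≟ a
... | yes _ = leftSub-tail-closed {P} tail δ (tail p)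
... | no _  = p

All-leftSub : ∀ {P : ℕ → Set} δ {α} → All P α → All P (leftSub δ α)
All-leftSub = leftSub-tail-closed All.tail

descending-leftSub : ∀ δ {α} → Descending α → Descending (leftSub δ α)
descending-leftSub = leftSub-tail-closed λ { (_ ∷ dα) → dα }

length-leftSub : ∀ δ α → length (leftSub δ α) ≤ length α
length-leftSub δ α =
  leftSub-tail-closed {P = λ β → length β ≤ length α}
                      (λ {_} {β} → ≤-trans (n≤1+n (length β))) δ ≤-refl

+ₒ-∷ˡ : ∀ {d} δ {β} → All (_≤ d) β → ((d ∷ δ) +ₒ β) ≡ d ∷ (δ +ₒ β)
+ₒ-∷ˡ δ {[]} _ = refl
+ₒ-∷ˡ {d} δ {b ∷ β} (b≤d ∷ _) with b ≤ᵇ d | ≤ᵇ-reflects-≤ b d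
... | true  | ofʸ _   = refl
... | false | ofⁿ b≰d = ⊥-elim (b≰d b≤d)

+ₒ-absorbˡ : ∀ {d a} δ α → d < a → ((d ∷ δ) +ₒ (a ∷ α)) ≡ a ∷ α
+ₒ-absorbˡ {d} {a} δ α d<a with a ≤ᵇ d | ≤ᵇ-reflects-≤ a d
... | true  | ofʸ a≤d = ⊥-elim (<⇒≱ d<a a≤d)
... | false | ofⁿ _   = refl

≤ₒ-tail : ∀ {d δ α} → (d ∷ δ) ≤ₒ (d ∷ α) → δ ≤ₒ α
≤ₒ-tail (inj₁ (this d<d)) = ⊥-elim (<-irrefl refl d<d)
≤ₒ-tail (inj₁ (next _ δ<α)) = inj₁ δ<α
≤ₒ-tail (inj₂ refl) = inj₂ refl

+ₒ-leftSub : ∀ δ {α} → δ ≤ₒ α → Descending α → (δ +ₒ leftSub δ α) ≡ α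
+ₒ-leftSub [] {[]} _ _ = refl
+ₒ-leftSub [] {a ∷ α} _ _ = refl
+ₒ-leftSub (d ∷ δ) {[]} (inj₁ ())
+ₒ-leftSub (d ∷ δ) {[]} (inj₂ ())
+ₒ-leftSub (d ∷ δ) {a ∷ α} δ≤α (α≤a ∷ dα) with d ≟ a
... | yes refl = begin
  (d ∷ δ) +ₒ leftSub δ α  ≡⟨ +ₒ-∷ˡ δ (All-leftSub δ α≤a) ⟩
  d ∷ (δ +ₒ leftSub δ α)  ≡⟨ cong (d ∷_) (+ₒ-leftSub δ (≤ₒ-tail δ≤α) dα) ⟩
  d ∷ α                   ∎
  where open ≡-Reasoning
... | no d≢a with δ≤α
...   | inj₁ (this d<a) = +ₒ-absorbˡ δ α d<a
...   | inj₁ (next d≡a _) = ⊥-elim (d≢a d≡a)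
...   | inj₂ refl = ⊥-elim (d≢a refl)

length-leftSub-< : ∀ {e} σ {α} → (e ∷ σ) ≤ₒ α → All (_≤ e) α →
  length (leftSub (e ∷ σ) α) < length α
length-leftSub-< σ {[]} (inj₁ ()) _
length-leftSub-< σ {[]} (inj₂ ()) _
length-leftSub-< {e} σ {a ∷ α} σ≤α (a≤e ∷ _) with e ≟ a
... | yes _ = s≤s (length-leftSub σ α)
... | no e≢a with σ≤α
...   | inj₁ (this e<a) = ⊥-elim (<⇒≱ e<a a≤e)
...   | inj₁ (next e≡a _) = ⊥-elim (e≢a e≡a)
...   | inj₂ refl = ⊥-elim (e≢a refl)

_·ₒ_+ₒ_ : Ord → ℕ → Ord → Ord
σ ·ₒ zero  +ₒ ι = ι
σ ·ₒ suc n +ₒ ι = σ +ₒ (σ ·ₒ n +ₒ ι)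

All-·ₒ+ₒ : ∀ {P : ℕ → Set} {σ ι} n → All P σ → All P ι → All P (σ ·ₒ n +ₒ ι)
All-·ₒ+ₒ zero pσ pι = pι
All-·ₒ+ₒ (suc n) pσ pι = All-+ₒ pσ (All-·ₒ+ₒ n pσ pι)

descending-·ₒ+ₒ : ∀ {σ ι} n → Descending σ → Descending ι → Descending (σ ·ₒ n +ₒ ι)
descending-·ₒ+ₒ zero dσ dι = dι
descending-·ₒ+ₒ (suc n) dσ dι = descending-+ₒ dσ (descending-·ₒ+ₒ n dσ dι)

·ₒ+ₒ-<·ω : ∀ {σ ι} n → Descending σ → Descending ι → ι <ₒ σ → (σ ·ₒ n +ₒ ι) <ₒ (σ ·ω)
·ₒ+ₒ-<·ω {[]} n _ _ (base ())
·ₒ+ₒ-<·ω {e ∷ σ} n (σ≤e ∷ _) dι ι<σ =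
  All≤⇒<ω^suc (All-·ₒ+ₒ n (≤-refl ∷ σ≤e) (<ω^suc⇒All≤ dι (<ₒ-trans ι<σ (this (n<1+n e)))))

·ₒ+ₒ-monoʳ-< : ∀ {σ ι κ} n → ι <ₒ κ → (σ ·ₒ n +ₒ ι) <ₒ (σ ·ₒ n +ₒ κ)
·ₒ+ₒ-monoʳ-< zero ι<κ = ι<κ
·ₒ+ₒ-monoʳ-< {σ} (suc n) ι<κ = +ₒ-monoʳ-< σ (·ₒ+ₒ-monoʳ-< n ι<κ)

·ₒ+ₒ-monoˡ-< : ∀ {σ ι κ m n} → m < n → ι <ₒ σ → (σ ·ₒ m +ₒ ι) <ₒ (σ ·ₒ n +ₒ κ)
·ₒ+ₒ-monoˡ-< {σ} {κ = κ} {zero} {suc n} _ ι<σ = <ₒ-≤ₒ-trans ι<σ (α≤ₒα+ₒβ σ (σ ·ₒ n +ₒ κ))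
·ₒ+ₒ-monoˡ-< {σ} {m = suc m} {suc n} (s≤s m<n) ι<σ = +ₒ-monoʳ-< σ (·ₒ+ₒ-monoˡ-< m<n ι<σ)

quotFuel : ℕ → Ord → Ord → ℕ
quotFuel zero σ ι = 0
quotFuel (suc k) σ ι = if does (ι <ₒ? σ) then 0 else suc (quotFuel k σ (leftSub σ ι))

quot : Ord → Ord → ℕ
quot σ ι = quotFuel (length ι) σ ι

descending-remFuel : ∀ k σ {ι} → Descending ι → Descending (remFuel k σ ι)
descending-remFuel zero σ dι = dι
descending-remFuel (suc k) σ {ι} dι with does (ι <ₒ? σ)
... | true = dι
... | false = descending-remFuel k σ (descending-leftSub σ dι)

descending-rem : ∀ σ {ι} → Descending ι → Descending (rem σ ι)
descending-rem σ {ι} = descending-remFuel (length ι) σ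

division-fuel : ∀ k e σ ι → length ι ≤ k → Descending ι → All (_≤ e) ι →
  ((e ∷ σ) ·ₒ quotFuel k (e ∷ σ) ι +ₒ remFuel k (e ∷ σ) ι) ≡ ι × remFuel k (e ∷ σ) ι <ₒ (e ∷ σ)
division-fuel zero e σ [] _ _ _ = refl , halt
division-fuel (suc k) e σ ι ∣ι∣≤k dι ι≤e with ι <ₒ? (e ∷ σ)
... | yes ι<σ = refl , ι<σ
... | no ι≮σ = Product.map₁ (λ eq → trans (cong ((e ∷ σ) +ₒ_) eq) (+ₒ-leftSub (e ∷ σ) σ≤ι dι))
  (division-fuel k e σ (leftSub (e ∷ σ) ι) fuel
                 (descending-leftSub (e ∷ σ) dι) (All-leftSub (e ∷ σ) ι≤e))
  where
  σ≤ι = ≮ₒ⇒≥ₒ ι≮σ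
  fuel = ≤-pred (≤-trans (length-leftSub-< σ σ≤ι ι≤e) ∣ι∣≤k)

division : ∀ σ {ι} → Descending ι → ι <ₒ (σ ·ω) → (σ ·ₒ quot σ ι +ₒ rem σ ι) ≡ ι × rem σ ι <ₒ σ
division [] _ (base ())
division (e ∷ σ) {ι} dι ι<σω = division-fuel (length ι) e σ ι ≤-refl dι (<ω^suc⇒All≤ dι ι<σω)

descending-·ω : ∀ α → Descending (α ·ω)
descending-·ω [] = []
descending-·ω (_ ∷ _) = [] ∷ []

·ω-nonempty : ∀ {α} → α ≢ [] → (α ·ω) ≢ []
·ω-nonempty {[]} α≢[] = ⊥-elim (α≢[] refl)
·ω-nonempty {_ ∷ _} _ ()

+ₒ-nonempty : ∀ α {β} → β ≢ [] → (α +ₒ β) ≢ []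
+ₒ-nonempty α {[]} β≢[] = ⊥-elim (β≢[] refl)
+ₒ-nonempty α {b ∷ β} _ eq with ++-conicalʳ (takeWhile (b ≤?_) α) (b ∷ β) eq
... | ()

module LabelledOrders {Q : Set} (_⊴_ : Q → Q → Set) where

  record LabelledOrder : Set₁ where
    constructor labelledOrder
    field
      Carrier : Set
      _≺_ : Carrier → Carrier → Set
      labelOf : Carrier → Q

  open LabelledOrder using (Carrier; labelOf)

  _∋_≺_ : (A : LabelledOrder) → Carrier A → Carrier A → Set
  A ∋ a ≺ a′ = LabelledOrder._≺_ A a a′

  record _↪_ (A B : LabelledOrder) : Set where
    field
      to : Carrier A → Carrier B
      to-⊴ : ∀ a → labelOf A a ⊴ labelOf B (to a)
      to-< : ∀ {a a′} → A ∋ a ≺ a′ → B ∋ to a ≺ to a′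

  open _↪_

  record Inclusion (A B : LabelledOrder) : Set where
    field
      incl : Carrier A → Carrier B
      incl-label : ∀ a → labelOf B (incl a) ≡ labelOf A a
      incl-< : ∀ {a a′} → A ∋ a ≺ a′ → B ∋ incl a ≺ incl a′

  open Inclusion

  Bounded : ∀ {A B} → A ↪ B → Set
  Bounded {B = B} e = ∃ λ w → ∀ a → B ∋ to e a ≺ w

  restrict : ∀ {A B C} → A ↪ B → Inclusion C A → C ↪ B
  to (restrict e i) c = to e (incl i c)
  to-⊴ (restrict {B = B} e i) c =
    subst (_⊴ labelOf B (to e (incl i c))) (incl-label i c) (to-⊴ e (incl i c))
  to-< (restrict e i) c<c′ = to-< e (incl-< i c<c′)

  restrict-bounded : ∀ {A B C} (e : A ↪ B) (i : Inclusion C A) → Bounded e → Bounded (restrict e i)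
  restrict-bounded e i (w , below) = w , λ c → below (incl i c)

  extend : ∀ {A B C} → Inclusion B C → A ↪ B → A ↪ C
  to (extend i e) a = incl i (to e a)
  to-⊴ (extend {A} i e) a = subst (labelOf A a ⊴_) (sym (incl-label i (to e a))) (to-⊴ e a)
  to-< (extend i e) a<a′ = incl-< i (to-< e a<a′)

  ↪-refl : ∀ {A} → (∀ {x} → x ⊴ x) → A ↪ A
  to (↪-refl ⊴-refl) a = a
  to-⊴ (↪-refl ⊴-refl) a = ⊴-refl
  to-< (↪-refl ⊴-refl) a<a′ = a<a′

  factor : ∀ {A B C} (i : Inclusion C B) → (∀ {c c′} → B ∋ incl i c ≺ incl i c′ → C ∋ c ≺ c′) →
    (e : A ↪ B) (g : Carrier A → Carrier C) → (∀ a → to e a ≡ incl i (g a)) → A ↪ C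
  to (factor i reflects e g e≡ig) = g
  to-⊴ (factor {A} {B} i reflects e g e≡ig) a =
    subst (labelOf A a ⊴_) (trans (cong (labelOf B) (e≡ig a)) (incl-label i (g a))) (to-⊴ e a)
  to-< (factor {B = B} i reflects e g e≡ig) {a} {a′} a<a′ =
    reflects (subst₂ (B ∋_≺_) (e≡ig a) (e≡ig a′) (to-< e a<a′))

module TreePositions {Q : Set} (_⊴_ : Q → Q → Set) where
  open TreeDefs _⊴_
  open LabelledOrders _⊴_
  open LabelledOrder using (Carrier; labelOf)
  open _↪_
  open Inclusion

  ≼-tail : ∀ {σ τ : Seq Q} δ γ (e : σ ≼ τ) → (∀ ι → Valid ι → ι <ₒ len σ → δ ≤ₒ proj₁ e ι) →
    (δ +ₒ γ) ≡ len τ → σ ≼ mkSeq γ (λ ι → at τ (δ +ₒ ι))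
  ≼-tail {σ} {τ} δ γ (h , h-valid , h-mono) δ≤h δ+γ≡τ = h′ , h′-valid , h′-mono
    where
    h′ : Ord → Ord
    h′ ι = leftSub δ (h ι)
    δ+h′ : ∀ ι → Valid ι → ι <ₒ len σ → (δ +ₒ h′ ι) ≡ h ι
    δ+h′ ι vι ι<σ = +ₒ-leftSub δ (δ≤h ι vι ι<σ) (valid⇒descending (proj₁ (h-valid ι vι ι<σ)))
    h′-valid : ∀ ι → Valid ι → ι <ₒ len σ → Valid (h′ ι) × h′ ι <ₒ γ × at σ ι ⊴ at τ (δ +ₒ h′ ι)
    h′-valid ι vι ι<σ with h-valid ι vι ι<σ
    ... | vh , h<τ , σι⊴τh =
      descending⇒valid (descending-leftSub δ (valid⇒descending vh)) ,
      +ₒ-cancelˡ-< δ (subst₂ _<ₒ_ (sym (δ+h′ ι vι ι<σ)) (sym δ+γ≡τ) h<τ) ,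
      subst (λ κ → at σ ι ⊴ at τ κ) (sym (δ+h′ ι vι ι<σ)) σι⊴τh
    h′-mono : ∀ ι κ → Valid ι → Valid κ → ι <ₒ κ → κ <ₒ len σ → h′ ι <ₒ h′ κ
    h′-mono ι κ vι vκ ι<κ κ<σ = +ₒ-cancelˡ-< δ
      (subst₂ _<ₒ_ (sym (δ+h′ ι vι (<ₒ-trans ι<κ κ<σ))) (sym (δ+h′ κ vκ κ<σ))
                   (h-mono ι κ vι vκ ι<κ κ<σ))

  -- Positions of f τ

  -- node-pos n y is the position y in the n-th copy of sumF t ts inside
  -- f (node (t ∷ ts)) = (sumF t ts)^ω.
  mutual
    data Pos : Tree → Set where
      leaf-pos : ∀ {q} → Pos (leaf q)
      node-pos : ∀ {t ts} → ℕ → Pos⁺ t ts → Pos (node (t ∷ ts))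

    data Pos⁺ : Tree → List Tree → Set where
      left  : ∀ {t ts} → Pos t → Pos⁺ t ts
      right : ∀ {t u us} → Pos⁺ u us → Pos⁺ t (u ∷ us)

  mutual
    label : ∀ {t} → Pos t → Q
    label (leaf-pos {q}) = q
    label (node-pos _ y) = label⁺ y

    label⁺ : ∀ {t ts} → Pos⁺ t ts → Q
    label⁺ (left p) = label p
    label⁺ (right y) = label⁺ y

  mutual
    data _<ₚ_ : ∀ {t} → Pos t → Pos t → Set where
      copy< : ∀ {t ts m n} {y y′ : Pos⁺ t ts} → m < n → node-pos m y <ₚ node-pos n y′
      same-copy : ∀ {t ts n} {y y′ : Pos⁺ t ts} → y <⁺ y′ → node-pos n y <ₚ node-pos n y′

    data _<⁺_ : ∀ {t ts} → Pos⁺ t ts → Pos⁺ t ts → Set where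
      left< : ∀ {t ts} {p p′ : Pos t} → p <ₚ p′ → left {ts = ts} p <⁺ left p′
      left<right : ∀ {t u us} {p : Pos t} {y : Pos⁺ u us} → left p <⁺ right y
      right< : ∀ {t u us} {y y′ : Pos⁺ u us} → y <⁺ y′ → right {t} y <⁺ right y′

  _≤ₚ_ : ∀ {t} → Pos t → Pos t → Set
  p ≤ₚ p′ = p <ₚ p′ ⊎ p ≡ p′

  _≤⁺_ : ∀ {t ts} → Pos⁺ t ts → Pos⁺ t ts → Set
  y ≤⁺ y′ = y <⁺ y′ ⊎ y ≡ y′

  mutual
    <ₚ-cmp : ∀ {t} (p p′ : Pos t) → p <ₚ p′ ⊎ p ≡ p′ ⊎ p′ <ₚ p
    <ₚ-cmp leaf-pos leaf-pos = inj₂ (inj₁ refl)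
    <ₚ-cmp (node-pos m y) (node-pos n y′) with <-cmp m n
    ... | tri< m<n _ _ = inj₁ (copy< m<n)
    ... | tri> _ _ n<m = inj₂ (inj₂ (copy< n<m))
    ... | tri≈ _ refl _ = Sum.map same-copy (Sum.map (cong (node-pos m)) same-copy) (<⁺-cmp y y′)

    <⁺-cmp : ∀ {t ts} (y y′ : Pos⁺ t ts) → y <⁺ y′ ⊎ y ≡ y′ ⊎ y′ <⁺ y
    <⁺-cmp (left p) (left p′) = Sum.map left< (Sum.map (cong left) left<) (<ₚ-cmp p p′)
    <⁺-cmp (left p) (right y) = inj₁ left<right
    <⁺-cmp (right y) (left p) = inj₂ (inj₂ left<right)
    <⁺-cmp (right y) (right y′) = Sum.map right< (Sum.map (cong right) right<) (<⁺-cmp y y′)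

  mutual
    enc : ∀ {t} → Pos t → Ord
    enc leaf-pos = []
    enc (node-pos {t} {ts} n y) = len (sumF t ts) ·ₒ n +ₒ enc⁺ y

    enc⁺ : ∀ {t ts} → Pos⁺ t ts → Ord
    enc⁺ (left p) = enc p
    enc⁺ (right {t} y) = len (f t) +ₒ enc⁺ y

  mutual
    dec : ∀ t → Ord → Pos t
    dec (leaf q) ι = leaf-pos
    dec (node (t ∷ ts)) ι = node-pos (quot σ ι) (dec⁺ t ts (rem σ ι))
      where σ = len (sumF t ts)

    dec⁺ : ∀ t ts → Ord → Pos⁺ t ts
    dec⁺ t [] ι = left (dec t ι)
    dec⁺ t (u ∷ us) ι =
      if does (ι <ₒ? len (f t)) then left (dec t ι) else right (dec⁺ u us (leftSub (len (f t)) ι))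

  mutual
    at-f : ∀ t ι → at (f t) ι ≡ label (dec t ι)
    at-f (leaf q) ι = refl
    at-f (node (t ∷ ts)) ι = at-sumF t ts (rem (len (sumF t ts)) ι)

    at-sumF : ∀ t ts ι → at (sumF t ts) ι ≡ label⁺ (dec⁺ t ts ι)
    at-sumF t [] ι = at-f t ι
    at-sumF t (u ∷ us) ι with does (ι <ₒ? len (f t))
    ... | true = at-f t ι
    ... | false = at-sumF u us (leftSub (len (f t)) ι)

  mutual
    descending-len-f : ∀ t → Descending (len (f t))
    descending-len-f (leaf q) = [] ∷ []
    descending-len-f (node (t ∷ ts)) = descending-·ω (len (sumF t ts))

    descending-len-sumF : ∀ t ts → Descending (len (sumF t ts))
    descending-len-sumF t [] = descending-len-f t
    descending-len-sumF t (u ∷ us) = descending-+ₒ (descending-len-f t) (descending-len-sumF u us)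

  mutual
    len-f-nonempty : ∀ t → len (f t) ≢ []
    len-f-nonempty (leaf q) ()
    len-f-nonempty (node (t ∷ ts)) = ·ω-nonempty (len-sumF-nonempty t ts)

    len-sumF-nonempty : ∀ t ts → len (sumF t ts) ≢ []
    len-sumF-nonempty t [] = len-f-nonempty t
    len-sumF-nonempty t (u ∷ us) = +ₒ-nonempty (len (f t)) (len-sumF-nonempty u us)

  mutual
    descending-enc : ∀ {t} (p : Pos t) → Descending (enc p)
    descending-enc leaf-pos = []
    descending-enc (node-pos {t} {ts} n y) =
      descending-·ₒ+ₒ n (descending-len-sumF t ts) (descending-enc⁺ y)

    descending-enc⁺ : ∀ {t ts} (y : Pos⁺ t ts) → Descending (enc⁺ y)
    descending-enc⁺ (left p) = descending-enc p
    descending-enc⁺ (right {t} y) = descending-+ₒ (descending-len-f t) (descending-enc⁺ y)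

  mutual
    enc-< : ∀ {t} (p : Pos t) → enc p <ₒ len (f t)
    enc-< leaf-pos = halt
    enc-< (node-pos {t} {ts} n y) =
      ·ₒ+ₒ-<·ω n (descending-len-sumF t ts) (descending-enc⁺ y) (enc⁺-< y)

    enc⁺-< : ∀ {t ts} (y : Pos⁺ t ts) → enc⁺ y <ₒ len (sumF t ts)
    enc⁺-< {ts = []} (left p) = enc-< p
    enc⁺-< {t} {u ∷ us} (left p) = <ₒ-≤ₒ-trans (enc-< p) (α≤ₒα+ₒβ (len (f t)) (len (sumF u us)))
    enc⁺-< (right {t} y) = +ₒ-monoʳ-< (len (f t)) (enc⁺-< y)

  mutual
    enc-dec : ∀ t {ι} → Descending ι → ι <ₒ len (f t) → enc (dec t ι) ≡ ι
    enc-dec (leaf q) {[]} _ _ = refl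
    enc-dec (leaf q) {_ ∷ _} _ (this ())
    enc-dec (leaf q) {_ ∷ _} _ (next _ (base ()))
    enc-dec (node (t ∷ ts)) {ι} dι ι<len = begin
      σ ·ₒ quot σ ι +ₒ enc⁺ (dec⁺ t ts (rem σ ι))
        ≡⟨ cong (σ ·ₒ quot σ ι +ₒ_) (enc⁺-dec⁺ t ts (descending-rem σ dι) rem<σ) ⟩
      σ ·ₒ quot σ ι +ₒ rem σ ι
        ≡⟨ σquot+rem≡ι ⟩
      ι ∎
      where
      open ≡-Reasoning
      σ = len (sumF t ts)
      σquot+rem≡ι = proj₁ (division σ dι ι<len)
      rem<σ = proj₂ (division σ dι ι<len)

    enc⁺-dec⁺ : ∀ t ts {ι} → Descending ι → ι <ₒ len (sumF t ts) → enc⁺ (dec⁺ t ts ι) ≡ ι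
    enc⁺-dec⁺ t [] dι ι<len = enc-dec t dι ι<len
    enc⁺-dec⁺ t (u ∷ us) {ι} dι ι<len with ι <ₒ? len (f t)
    ... | yes ι<f = enc-dec t dι ι<f
    ... | no ι≮f = begin
      len (f t) +ₒ enc⁺ (dec⁺ u us κ)
        ≡⟨ cong (len (f t) +ₒ_) (enc⁺-dec⁺ u us (descending-leftSub (len (f t)) dι) κ<len) ⟩
      len (f t) +ₒ κ
        ≡⟨ f+κ≡ι ⟩
      ι ∎
      where
      open ≡-Reasoning
      κ = leftSub (len (f t)) ι
      f+κ≡ι = +ₒ-leftSub (len (f t)) (≮ₒ⇒≥ₒ ι≮f) dι
      κ<len = +ₒ-cancelˡ-< (len (f t)) (subst (_<ₒ len (sumF t (u ∷ us))) (sym f+κ≡ι) ι<len)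

  mutual
    enc-mono : ∀ {t} {p p′ : Pos t} → p <ₚ p′ → enc p <ₒ enc p′
    enc-mono (copy< {y = y} m<n) = ·ₒ+ₒ-monoˡ-< m<n (enc⁺-< y)
    enc-mono (same-copy {n = n} y<y′) = ·ₒ+ₒ-monoʳ-< n (enc⁺-mono y<y′)

    enc⁺-mono : ∀ {t ts} {y y′ : Pos⁺ t ts} → y <⁺ y′ → enc⁺ y <ₒ enc⁺ y′
    enc⁺-mono (left< p<p′) = enc-mono p<p′
    enc⁺-mono (left<right {t} {p = p} {y}) = <ₒ-≤ₒ-trans (enc-< p) (α≤ₒα+ₒβ (len (f t)) (enc⁺ y))
    enc⁺-mono (right< {t} y<y′) = +ₒ-monoʳ-< (len (f t)) (enc⁺-mono y<y′)

  module _ {t : Tree} where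
    open StrictlyMonotone (<ₚ-cmp {t}) <ₒ-irrefl <ₒ-asym enc-mono public
      renaming (reflects to enc-reflects; injective to enc-injective)

  dec-enc : ∀ {t} (p : Pos t) → dec t (enc p) ≡ p
  dec-enc {t} p = enc-injective (enc-dec t (descending-enc p) (enc-< p))

  enc-valid : ∀ {t} (p : Pos t) → Valid (enc p)
  enc-valid p = descending⇒valid (descending-enc p)

  dec-mono : ∀ t {ι κ} → Descending ι → Descending κ → ι <ₒ κ → κ <ₒ len (f t) → dec t ι <ₚ dec t κ
  dec-mono t dι dκ ι<κ κ<len =
    enc-reflects (subst₂ _<ₒ_ (sym (enc-dec t dι (<ₒ-trans ι<κ κ<len))) (sym (enc-dec t dκ κ<len))
                              ι<κ)

  Positions : Tree → LabelledOrder
  Positions t = labelledOrder (Pos t) _<ₚ_ label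

  Positions⁺ : Tree → List Tree → LabelledOrder
  Positions⁺ t ts = labelledOrder (Pos⁺ t ts) _<⁺_ label⁺

  ↪⇒≼ : ∀ {s t} → Positions s ↪ Positions t → f s ≼ f t
  ↪⇒≼ {s} {t} e = h , h-valid , h-mono
    where
    h : Ord → Ord
    h ι = enc (to e (dec s ι))
    at-h : ∀ ι → at (f t) (h ι) ≡ label (to e (dec s ι))
    at-h ι = trans (at-f t (h ι)) (cong label (dec-enc (to e (dec s ι))))
    h-valid : ∀ ι → Valid ι → ι <ₒ len (f s) →
      Valid (h ι) × h ι <ₒ len (f t) × at (f s) ι ⊴ at (f t) (h ι)
    h-valid ι _ _ = enc-valid (to e (dec s ι)) , enc-< (to e (dec s ι)) ,
      subst₂ _⊴_ (sym (at-f s ι)) (sym (at-h ι)) (to-⊴ e (dec s ι))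
    h-mono : ∀ ι κ → Valid ι → Valid κ → ι <ₒ κ → κ <ₒ len (f s) → h ι <ₒ h κ
    h-mono ι κ vι vκ ι<κ κ<len =
      enc-mono (to-< e (dec-mono s (valid⇒descending vι) (valid⇒descending vκ) ι<κ κ<len))

  ≼⇒↪ : ∀ {s t} → f s ≼ f t → Positions s ↪ Positions t
  ≼⇒↪ {s} {t} (h , h-valid , h-mono) = record { to = g ; to-⊴ = g-⊴ ; to-< = g-< }
    where
    g : Pos s → Pos t
    g p = dec t (h (enc p))
    h-enc-valid : (p : Pos s) →
      Valid (h (enc p)) × h (enc p) <ₒ len (f t) × at (f s) (enc p) ⊴ at (f t) (h (enc p))
    h-enc-valid p = h-valid (enc p) (enc-valid p) (enc-< p)
    g-⊴ : ∀ p → label p ⊴ label (g p)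
    g-⊴ p = subst₂ _⊴_ (trans (at-f s (enc p)) (cong label (dec-enc p))) (at-f t (h (enc p)))
                       (proj₂ (proj₂ (h-enc-valid p)))
    g-< : ∀ {p p′} → p <ₚ p′ → g p <ₚ g p′
    g-< {p} {p′} p<p′ =
      dec-mono t (valid⇒descending (proj₁ (h-enc-valid p))) (valid⇒descending (proj₁ (h-enc-valid p′)))
        (h-mono (enc p) (enc p′) (enc-valid p) (enc-valid p′) (enc-mono p<p′) (enc-< p′))
        (proj₁ (proj₂ (h-enc-valid p′)))

  -- Tree embeddings and position embeddings

  copy# : ∀ {t ts} → Pos (node (t ∷ ts)) → ℕ
  copy# (node-pos n _) = n

  inner : ∀ {t ts} → Pos (node (t ∷ ts)) → Pos⁺ t ts
  inner (node-pos _ y) = y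

  label-inner : ∀ {t ts} (p : Pos (node (t ∷ ts))) → label⁺ (inner p) ≡ label p
  label-inner (node-pos _ _) = refl

  shift : ∀ {t ts} → ℕ → Pos (node (t ∷ ts)) → Pos (node (t ∷ ts))
  shift k p = node-pos (k + copy# p) (inner p)

  shift-< : ∀ {t ts k} {p p′ : Pos (node (t ∷ ts))} → p <ₚ p′ → shift k p <ₚ shift k p′
  shift-< {k = k} (copy< m<n) = copy< (+-monoʳ-< k m<n)
  shift-< (same-copy y<y′) = same-copy y<y′

  left-incl : ∀ {t ts} → Inclusion (Positions t) (Positions⁺ t ts)
  left-incl = record { incl = left ; incl-label = λ _ → refl ; incl-< = left< }

  right-incl : ∀ {t u us} → Inclusion (Positions⁺ u us) (Positions⁺ t (u ∷ us))
  right-incl = record { incl = right ; incl-label = λ _ → refl ; incl-< = right< }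

  copy-incl : ∀ {t ts} → ℕ → Inclusion (Positions⁺ t ts) (Positions (node (t ∷ ts)))
  copy-incl n = record { incl = node-pos n ; incl-label = λ _ → refl ; incl-< = same-copy }

  shift-incl : ∀ {t ts} → ℕ → Inclusion (Positions (node (t ∷ ts))) (Positions (node (t ∷ ts)))
  shift-incl k = record { incl = shift k ; incl-label = label-inner ; incl-< = shift-< }

  CopiesBelow : ∀ {A t ts} → ℕ → A ↪ Positions (node (t ∷ ts)) → Set
  CopiesBelow K e = ∀ a → copy# (to e a) < K

  spread : ∀ {s ss t ts} K (e : Positions⁺ s ss ↪ Positions (node (t ∷ ts))) → CopiesBelow K e →
    Positions (node (s ∷ ss)) ↪ Positions (node (t ∷ ts))
  spread K e below = record { to = g ; to-⊴ = g-⊴ ; to-< = g-< }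
    where
    into-copy : ℕ → Positions⁺ _ _ ↪ Positions (node _)
    into-copy n = extend (shift-incl (n * K)) e
    g : Pos (node _) → Pos (node _)
    g (node-pos n y) = to (into-copy n) y
    g-⊴ : ∀ p → label p ⊴ label (g p)
    g-⊴ (node-pos n y) = to-⊴ (into-copy n) y
    g-< : ∀ {p p′} → p <ₚ p′ → g p <ₚ g p′
    g-< (copy< {y = y} m<n) = copy< (mixed-radix-< K m<n (below y))
    g-< (same-copy {n = n} y<y′) = to-< (into-copy n) y<y′

  mutual
    ≤T⇒↪ : ∀ {s t} → s ≤T t → Positions s ↪ Positions t
    ≤T⇒↪ (leaf≤leaf x⊴y) = record { to = λ _ → leaf-pos ; to-⊴ = λ { leaf-pos → x⊴y } ; to-< = λ () }
    ≤T⇒↪ (leaf≤node {ts = _ ∷ _} s≤ts) = extend (copy-incl 0) (any≤T⇒↪ s≤ts)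
    ≤T⇒↪ (node≤node {ss = _ ∷ ss} {ts = _ ∷ _} ss≤ts) =
      spread (suc (length ss)) (proj₁ (all≤T⇒↪ ss≤ts)) (proj₂ (all≤T⇒↪ ss≤ts))

    any≤T⇒↪ : ∀ {s t ts} → Any (s ≤T_) (t ∷ ts) → Positions s ↪ Positions⁺ t ts
    any≤T⇒↪ (here s≤t) = extend left-incl (≤T⇒↪ s≤t)
    any≤T⇒↪ {ts = _ ∷ _} (there s≤ts) = extend right-incl (any≤T⇒↪ s≤ts)

    all≤T⇒↪ : ∀ {s ss t ts} → All (λ s → Any (s ≤T_) (t ∷ ts)) (s ∷ ss) →
      Σ (Positions⁺ s ss ↪ Positions (node (t ∷ ts))) (CopiesBelow (suc (length ss)))
    all≤T⇒↪ {ss = []} (s≤ts ∷ []) =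
      record { to = g ; to-⊴ = g-⊴ ; to-< = g-< } , λ { (left _) → s≤s z≤n }
      where
      e₀ = any≤T⇒↪ s≤ts
      g : Pos⁺ _ [] → Pos (node _)
      g (left p) = node-pos 0 (to e₀ p)
      g-⊴ : ∀ y → label⁺ y ⊴ label (g y)
      g-⊴ (left p) = to-⊴ e₀ p
      g-< : ∀ {y y′} → y <⁺ y′ → g y <ₚ g y′
      g-< (left< p<p′) = same-copy (to-< e₀ p<p′)
    all≤T⇒↪ {ss = _ ∷ _} (s≤ts ∷ ss≤ts) = record { to = g ; to-⊴ = g-⊴ ; to-< = g-< } , below
      where
      e₀ = any≤T⇒↪ s≤ts
      e₊ = extend (shift-incl 1) (proj₁ (all≤T⇒↪ ss≤ts))
      g : Pos⁺ _ (_ ∷ _) → Pos (node _)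
      g (left p) = node-pos 0 (to e₀ p)
      g (right y) = to e₊ y
      g-⊴ : ∀ y → label⁺ y ⊴ label (g y)
      g-⊴ (left p) = to-⊴ e₀ p
      g-⊴ (right y) = to-⊴ e₊ y
      g-< : ∀ {y y′} → y <⁺ y′ → g y <ₚ g y′
      g-< (left< p<p′) = same-copy (to-< e₀ p<p′)
      g-< left<right = copy< (s≤s z≤n)
      g-< (right< y<y′) = to-< e₊ y<y′
      below : ∀ y → copy# (g y) < suc (suc _)
      below (left _) = s≤s z≤n
      below (right y) = s≤s (proj₂ (all≤T⇒↪ ss≤ts) y)

  mutual
    first : ∀ {t} → Pos t
    first {leaf _} = leaf-pos
    first {node (_ ∷ _)} = node-pos 0 first⁺

    first⁺ : ∀ {t ts} → Pos⁺ t ts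
    first⁺ = left first

  mutual
    first-≤ : ∀ {t} (p : Pos t) → first ≤ₚ p
    first-≤ leaf-pos = inj₂ refl
    first-≤ (node-pos zero y) = Sum.map same-copy (cong (node-pos 0)) (first⁺-≤ y)
    first-≤ (node-pos (suc n) y) = inj₁ (copy< (s≤s z≤n))

    first⁺-≤ : ∀ {t ts} (y : Pos⁺ t ts) → first⁺ ≤⁺ y
    first⁺-≤ (left p) = Sum.map left< (cong left) (first-≤ p)
    first⁺-≤ (right y) = inj₁ left<right

  child# : ∀ {t ts} → Pos⁺ t ts → ℕ
  child# (left _) = 0
  child# (right y) = suc (child# y)

  child#-≤ : ∀ {t ts} (y : Pos⁺ t ts) → child# y ≤ length ts
  child#-≤ (left _) = z≤n
  child#-≤ (right y) = s≤s (child#-≤ y)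

  child#-mono : ∀ {t ts} {y y′ : Pos⁺ t ts} → y <⁺ y′ → child# y ≤ child# y′
  child#-mono (left< _) = z≤n
  child#-mono left<right = z≤n
  child#-mono (right< y<y′) = s≤s (child#-mono y<y′)

  block# : ∀ {t ts} → Pos (node (t ∷ ts)) → ℕ
  block# {ts = ts} p = copy# p * suc (length ts) + child# (inner p)

  block#-mono : ∀ {t ts} {p p′ : Pos (node (t ∷ ts))} → p <ₚ p′ → block# p ≤ block# p′
  block#-mono {ts = ts} (copy< {y = y} m<n) =
    <⇒≤ (mixed-radix-< (suc (length ts)) m<n (s≤s (child#-≤ y)))
  block#-mono {ts = ts} (same-copy {n = n} y<y′) = +-monoʳ-≤ (n * suc (length ts)) (child#-mono y<y′)

  block#-injective : ∀ {t ts} (p p′ : Pos (node (t ∷ ts))) → block# p ≡ block# p′ →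
    copy# p ≡ copy# p′ × child# (inner p) ≡ child# (inner p′)
  block#-injective {ts = ts} (node-pos m y) (node-pos n y′) eq with <-cmp m n
  ... | tri< m<n _ _ =
    ⊥-elim (<-irrefl eq (mixed-radix-< (suc (length ts)) m<n (s≤s (child#-≤ y))))
  ... | tri> _ _ n<m =
    ⊥-elim (<-irrefl (sym eq) (mixed-radix-< (suc (length ts)) n<m (s≤s (child#-≤ y′))))
  ... | tri≈ _ refl _ = refl , +-cancelˡ-≡ (m * suc (length ts)) _ _ eq

  between-same-copy : ∀ {t ts} {lo p hi : Pos (node (t ∷ ts))} →
    lo ≤ₚ p → p <ₚ hi → copy# lo ≡ copy# hi →
    copy# p ≡ copy# lo × inner lo ≤⁺ inner p × inner p <⁺ inner hi
  between-same-copy (inj₂ refl) (same-copy y<hi) _ = refl , inj₂ refl , y<hi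
  between-same-copy (inj₁ (same-copy lo<y)) (same-copy y<hi) _ = refl , inj₁ lo<y , y<hi
  between-same-copy (inj₂ refl) (copy< m<n) m≡n = ⊥-elim (<-irrefl m≡n m<n)
  between-same-copy (inj₁ (same-copy _)) (copy< m<n) m≡n = ⊥-elim (<-irrefl m≡n m<n)
  between-same-copy (inj₁ (copy< l<m)) (same-copy _) l≡m = ⊥-elim (<-irrefl l≡m l<m)
  between-same-copy (inj₁ (copy< l<m)) (copy< m<h) l≡h = ⊥-elim (<-irrefl l≡h (<-trans l<m m<h))

  project : ∀ {A t ts} (e : A ↪ Positions (node (t ∷ ts))) m → (∀ a → copy# (to e a) ≡ m) →
    A ↪ Positions⁺ t ts
  to (project e m in-m) = inner ∘ to e
  to-⊴ (project {A} e m in-m) a = subst (labelOf A a ⊴_) (sym (label-inner (to e a))) (to-⊴ e a)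
  to-< (project e m in-m) {a} {a′} a<a′ = inner-< (trans (in-m a) (sym (in-m a′))) (to-< e a<a′)
    where
    inner-< : ∀ {p p′ : Pos (node _)} → copy# p ≡ copy# p′ → p <ₚ p′ → inner p <⁺ inner p′
    inner-< m≡n (copy< m<n) = ⊥-elim (<-irrefl m≡n m<n)
    inner-< _ (same-copy y<y′) = y<y′

  left-<⁻¹ : ∀ {t ts} {p p′ : Pos t} → left {ts = ts} p <⁺ left p′ → p <ₚ p′
  left-<⁻¹ (left< p<p′) = p<p′

  right-<⁻¹ : ∀ {t u us} {y y′ : Pos⁺ u us} → right {t} y <⁺ right y′ → y <⁺ y′
  right-<⁻¹ (right< y<y′) = y<y′

  below-left : ∀ {t ts} {y : Pos⁺ t ts} {b : Pos t} → y <⁺ left b → ∃ λ p → y ≡ left p × p <ₚ b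
  below-left (left< {p = p} p<b) = p , refl , p<b

  above-right : ∀ {t u us} {a : Pos⁺ u us} {y : Pos⁺ t (u ∷ us)} → right a ≤⁺ y →
    ∃ λ y′ → y ≡ right y′ × a ≤⁺ y′
  above-right {a = a} (inj₂ refl) = a , refl , inj₂ refl
  above-right (inj₁ (right< {y′ = y′} a<y′)) = y′ , refl , inj₁ a<y′

  between-same-child : ∀ {A t ts} (e : A ↪ Positions⁺ t ts) (lo hi : Pos⁺ t ts) →
    child# lo ≡ child# hi → (∀ a → lo ≤⁺ to e a) → (∀ a → to e a <⁺ hi) →
    Any (λ c → Σ (A ↪ Positions c) Bounded) (t ∷ ts)
  between-same-child e (left _) (left b) _ _ below =
    here (factor left-incl left-<⁻¹ e (proj₁ ∘ view) (proj₁ ∘ proj₂ ∘ view) ,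
          b , proj₂ ∘ proj₂ ∘ view)
    where view = λ a → below-left (below a)
  between-same-child {ts = _ ∷ _} e (right lo) (right hi) eq above below =
    there (between-same-child e′ lo hi (suc-injective eq) (proj₂ ∘ proj₂ ∘ view) below′)
    where
    view = λ a → above-right (above a)
    e′ = factor right-incl right-<⁻¹ e (proj₁ ∘ view) (proj₁ ∘ proj₂ ∘ view)
    below′ : ∀ a → to e′ a <⁺ hi
    below′ a = right-<⁻¹ (subst (_<⁺ right hi) (proj₁ (proj₂ (view a))) (below a))
  between-same-child {ts = _ ∷ _} e (left _) (right _) () _ _
  between-same-child {ts = _ ∷ _} e (right _) (left _) () _ _

  slice-in-child : ∀ {r rs t ts} (e : Positions (node (r ∷ rs)) ↪ Positions (node (t ∷ ts))) →
    Bounded e → Any (λ c → Σ (Positions⁺ r rs ↪ Positions c) Bounded) (t ∷ ts)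
  slice-in-child e (w , below) =
    between-same-child (project slice (copy# lo) (proj₁ ∘ in-copy-block)) (inner lo) (inner hi)
            (proj₂ same-block) (proj₁ ∘ proj₂ ∘ in-copy-block) (proj₂ ∘ proj₂ ∘ in-copy-block)
    where
    copy-start : ℕ → Pos (node _)
    copy-start k = to e (node-pos k first⁺)
    stall = monotone-bounded-stalls (block# ∘ copy-start)
              (λ k → block#-mono (to-< e (copy< (n<1+n k))))
              (block# w) (λ k → block#-mono (below (node-pos k first⁺)))
    k = proj₁ stall
    lo = copy-start k
    hi = copy-start (suc k)
    same-block = block#-injective lo hi (proj₂ stall)
    slice = restrict e (copy-incl k)
    in-copy-block : ∀ y →
      copy# (to slice y) ≡ copy# lo × inner lo ≤⁺ inner (to slice y) × inner (to slice y) <⁺ inner hi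
    in-copy-block y =
      between-same-copy (Sum.map (to-< e ∘ same-copy) (cong (to slice)) (first⁺-≤ y))
                        (to-< e (copy< (n<1+n k))) (proj₁ same-block)

  leaf≤node⁻¹ : ∀ {x ts} → leaf x ≤T node ts → Any (leaf x ≤T_) (toList ts)
  leaf≤node⁻¹ (leaf≤node x≤ts) = x≤ts

  ⊴label⇒leaf≤T : ∀ {x t} (p : Pos t) → x ⊴ label p → leaf x ≤T t
  ⊴label⇒leaf≤T leaf-pos x⊴q = leaf≤leaf x⊴q
  ⊴label⇒leaf≤T (node-pos _ y) x⊴y = leaf≤node (child y x⊴y)
    where
    child : ∀ {x t ts} (y : Pos⁺ t ts) → x ⊴ label⁺ y → Any (leaf x ≤T_) (t ∷ ts)
    child (left p) x⊴p = here (⊴label⇒leaf≤T p x⊴p)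
    child (right y) x⊴y = there (child y x⊴y)

  mutual
    bounded↪⇒≤child : ∀ {r t ts} (e : Positions r ↪ Positions (node (t ∷ ts))) → Bounded e →
      Any (r ≤T_) (t ∷ ts)
    bounded↪⇒≤child {leaf _} e _ = leaf≤node⁻¹ (⊴label⇒leaf≤T (to e leaf-pos) (to-⊴ e leaf-pos))
    bounded↪⇒≤child {node (_ ∷ _)} e bounded =
      Any.map (Product.uncurry bounded↪⇒node≤T) (slice-in-child e bounded)

    bounded↪⇒node≤T : ∀ {r rs c} (e : Positions⁺ r rs ↪ Positions c) → Bounded e →
      node (r ∷ rs) ≤T c
    bounded↪⇒node≤T {c = leaf _} e (leaf-pos , below) with below first⁺
    ... | ()
    bounded↪⇒node≤T {c = node (_ ∷ _)} e bounded = node≤node (bounded↪⇒all≤child e bounded)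

    bounded↪⇒all≤child : ∀ {r rs t ts} (e : Positions⁺ r rs ↪ Positions (node (t ∷ ts))) →
      Bounded e → All (λ r → Any (r ≤T_) (t ∷ ts)) (r ∷ rs)
    bounded↪⇒all≤child {rs = []} e bounded =
      bounded↪⇒≤child (restrict e left-incl) (restrict-bounded e left-incl bounded) ∷ []
    bounded↪⇒all≤child {rs = _ ∷ _} e bounded =
      bounded↪⇒≤child (restrict e left-incl) (restrict-bounded e left-incl bounded) ∷
      bounded↪⇒all≤child (restrict e right-incl) (restrict-bounded e right-incl bounded)

  ↪⇒≤T : ∀ {s t} → Positions s ↪ Positions t → s ≤T t
  ↪⇒≤T {leaf _} e = ⊴label⇒leaf≤T (to e leaf-pos) (to-⊴ e leaf-pos)
  ↪⇒≤T {node (_ ∷ _)} e =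
    bounded↪⇒node≤T (restrict e (copy-incl 0))
                    (to e (node-pos 1 first⁺) , λ _ → to-< e (copy< (s≤s z≤n)))

  -- f τ belongs to i^F_{ω^ω}(Q)

  f-indecomposable : (∀ {x} → x ⊴ x) → ∀ τ → Indecomposable (f τ)
  f-indecomposable _ (leaf _) δ γ _ _ halt (this ())
  f-indecomposable _ (leaf _) δ γ _ _ halt (next _ (base ()))
  f-indecomposable ⊴-refl τ@(node (_ ∷ _)) δ γ vδ _ _ δ<τ δ+γ≡τ =
    ≼-tail {f τ} {f τ} δ γ (↪⇒≼ shifted) δ≤shifted δ+γ≡τ
    where
    n = copy# (dec τ δ)
    shifted : Positions τ ↪ Positions τ
    shifted = extend (shift-incl (suc n)) (↪-refl ⊴-refl)
    δ≤shifted : ∀ ι → Valid ι → ι <ₒ len (f τ) → δ ≤ₒ enc (shift (suc n) (dec τ ι))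
    δ≤shifted ι _ _ =
      inj₁ (subst (_<ₒ enc (shift (suc n) p)) (enc-dec τ (valid⇒descending vδ) δ<τ)
                  (enc-mono {p = dec τ δ} {shift (suc n) p} (copy< (s≤s (m≤m+n n (copy# p))))))
      where p = dec τ ι

  mutual
    labels : Tree → List Q
    labels (leaf q) = q ∷ []
    labels (node (t ∷ ts)) = labels⁺ t ts

    labels⁺ : Tree → List Tree → List Q
    labels⁺ t [] = labels t
    labels⁺ t (u ∷ us) = labels t ++ labels⁺ u us

  mutual
    label∈labels : ∀ {t} (p : Pos t) → label p ∈ labels t
    label∈labels leaf-pos = here refl
    label∈labels (node-pos _ y) = label⁺∈labels⁺ y

    label⁺∈labels⁺ : ∀ {t ts} (y : Pos⁺ t ts) → label⁺ y ∈ labels⁺ t ts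
    label⁺∈labels⁺ {ts = []} (left p) = label∈labels p
    label⁺∈labels⁺ {ts = _ ∷ _} (left p) = ∈-++⁺ˡ (label∈labels p)
    label⁺∈labels⁺ (right {t} y) = ∈-++⁺ʳ (labels t) (label⁺∈labels⁺ y)

  f-finiteRange : ∀ τ → FiniteRange (f τ)
  f-finiteRange τ =
    labels τ , λ ι _ _ → subst (_∈ labels τ) (sym (at-f τ ι)) (label∈labels (dec τ ι))

  f-inIF : (∀ {x} → x ⊴ x) → ∀ τ → InIF (f τ)
  f-inIF ⊴-refl τ =
    descending⇒valid (descending-len-f τ) , len-f-nonempty τ ,
    f-finiteRange τ , f-indecomposable ⊴-refl τ

lemma4p18 : {Q : Set} (_≤_ : Q → Q → Set) → IsPreorder _≡_ _≤_ → Q →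
    let open TreeDefs _≤_ in
      (∀ τ → InIF (f τ)) × (∀ σ τ → (σ ≤T τ) ⇔ (f σ ≼ f τ))
lemma4p18 _⊴_ ⊴-isPreorder _ =
  f-inIF (IsPreorder.refl ⊴-isPreorder) , λ _ _ → mk⇔ (↪⇒≼ ∘ ≤T⇒↪) (↪⇒≤T ∘ ≼⇒↪)
  where open TreePositions _⊴_
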